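{- For all finite PCF-terms $M\sqsubseteq_{syn}N$ we have $\mathrm{approx}(M)\sqsubseteq_{syn}\mathrm{approx}(N)$.
   Context: PCF: types $\iota$, $\sigma\to\tau$; constants integers $0,1,2,\ldots$, $\mathrm{succ},\mathrm{pred}$, $\mathrm{if\ then\ else}$ (testing for $0$); terms $\Omega^\sigma$, variables, $\lambda$, application, $\mathbf{Y}M$; reductions $\beta$, $\mathbf{Y}M\to M(\mathbf{Y}M)$, arithmetic and conditional rules. $M\sqsubseteq_{obs}N$ iff for all contexts $P[\ ]$ with $P[M],P[N]$ closed of type $\iota$, $P[M]\to^*n$ implies $P[N]\to^*n$; $\equiv$ the induced equivalence. $M\sqsubseteq_{syn}N$ iff $N$ arises from $M$ by replacing some occurrences of $\Omega$ by terms. Finite projections $FP^\iota_i=\lambda x.\,\mathrm{if}\ x\ \mathrm{then}\ 0\ \mathrm{else}\ \ldots\ \mathrm{if}\ \mathrm{pred}^ix\ \mathrm{then}\ i\ \mathrm{else}\ \Omega$, $FP^{\sigma\to\tau}_i=\lambda f.\lambda x.FP^\tau_i(f(FP^\sigma_ix))$; a finite term is a closed $M:\sigma$ with $M\equiv FP^\sigma_iM$ for some $i$. $\to_{\beta Y}$ is one-step reduction by $\beta$ or $\mathbf{Y}M\to M(\mathbf{Y}M)$ in any context. $\omega(M)=\lambda x_1\ldots x_n.\,u\,\omega(M_1)\ldots\omega(M_m)$ if $M=\lambda x_1\ldots x_n.\,u\,M_1\ldots M_m$ with $u$ a variable or a constant other than $\Omega,\mathbf{Y}$, and $\omega(M)=\Omega$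 otherwise. For a finite term $M$, $\mathrm{approx}(M)$ is the unique $\sqsubseteq_{syn}$-least term $N'$ such that $N'\equiv M$ and $N'\sqsubseteq_{syn}\omega(N)$ for some $N$ with $M\to^*_{\beta Y}N$ (such a least term exists). -}

module Defs where

open import Data.Nat using (ℕ; zero; suc)
open import Data.List using (List; []; _∷_)
open import Data.Maybe using (Maybe; just; nothing; fromMaybe)
import Data.Maybe as Maybe
open import Data.Product using (Σ; ∃; _×_; _,_)
open import Relation.Binary.Construct.Closure.ReflexiveTransitive using (Star)

infixr 7 _⇒_
data Ty : Set where
  ι   : Ty
  _⇒_ : Ty → Ty → Ty

Ctx : Set
Ctx = List Ty

variable
  Γ Δ Θ : Ctx
  σ τ α β : Ty

data _∋_ : Ctx → Ty → Set where
  here  : (σ ∷ Γ) ∋ σ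
  there : Γ ∋ σ → (τ ∷ Γ) ∋ σ

data Tm (Γ : Ctx) : Ty → Set where
  var  : Γ ∋ σ → Tm Γ σ
  num  : ℕ → Tm Γ ι
  succ : Tm Γ (ι ⇒ ι)
  pred : Tm Γ (ι ⇒ ι)
  ifz  : Tm Γ (ι ⇒ ι ⇒ ι ⇒ ι)
  Ω    : (σ : Ty) → Tm Γ σ
  lam  : Tm (σ ∷ Γ) τ → Tm Γ (σ ⇒ τ)
  app  : Tm Γ (σ ⇒ τ) → Tm Γ σ → Tm Γ τ
  Y    : Tm Γ (σ ⇒ σ) → Tm Γ σ

Ren : Ctx → Ctx → Set
Ren Γ Δ = ∀ {σ} → Γ ∋ σ → Δ ∋ σ

extR : Ren Γ Δ → Ren (σ ∷ Γ) (σ ∷ Δ)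
extR ρ here      = here
extR ρ (there x) = there (ρ x)

rename : Ren Γ Δ → Tm Γ τ → Tm Δ τ
rename ρ (var x)   = var (ρ x)
rename ρ (num n)   = num n
rename ρ succ      = succ
rename ρ pred      = pred
rename ρ ifz       = ifz
rename ρ (Ω σ)     = Ω σ
rename ρ (lam M)   = lam (rename (extR ρ) M)
rename ρ (app M N) = app (rename ρ M) (rename ρ N)
rename ρ (Y M)     = Y (rename ρ M)

Sub : Ctx → Ctx → Set
Sub Γ Δ = ∀ {σ} → Γ ∋ σ → Tm Δ σ

extS : Sub Γ Δ → Sub (σ ∷ Γ) (σ ∷ Δ)
extS s here      = var here
extS s (there x) = rename there (s x)

subst : Sub Γ Δ → Tm Γ τ → Tm Δ τ
subst s (var x)   = s x
subst s (num n)   = num n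
subst s succ      = succ
subst s pred      = pred
subst s ifz       = ifz
subst s (Ω σ)     = Ω σ
subst s (lam M)   = lam (subst (extS s) M)
subst s (app M N) = app (subst s M) (subst s N)
subst s (Y M)     = Y (subst s M)

single : Tm Γ σ → Sub (σ ∷ Γ) Γ
single N here      = N
single N (there x) = var x

_[_] : Tm (σ ∷ Γ) τ → Tm Γ σ → Tm Γ τ
M [ N ] = subst (single N) M

data BaseβY {Γ} : ∀ {σ} → Tm Γ σ → Tm Γ σ → Set where
  β-rule : (M : Tm (σ ∷ Γ) τ) (N : Tm Γ σ) → BaseβY (app (lam M) N) (M [ N ])
  Y-rule : (M : Tm Γ (σ ⇒ σ)) → BaseβY (Y M) (app M (Y M))

data BasePCF {Γ} : ∀ {σ} → Tm Γ σ → Tm Γ σ → Set where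
  βY     : {M N : Tm Γ σ} → BaseβY M N → BasePCF M N
  succ-n : (n : ℕ) → BasePCF (app succ (num n)) (num (suc n))
  pred-0 : BasePCF (app pred (num 0)) (num 0)
  pred-s : (n : ℕ) → BasePCF (app pred (num (suc n))) (num n)
  if-0   : (M N : Tm Γ ι) → BasePCF (app (app (app ifz (num 0)) M) N) M
  if-s   : (n : ℕ) (M N : Tm Γ ι) → BasePCF (app (app (app ifz (num (suc n))) M) N) N

data Compat (R : ∀ {Γ σ} → Tm Γ σ → Tm Γ σ → Set) : ∀ {Γ σ} → Tm Γ σ → Tm Γ σ → Set where
  base : ∀ {Γ σ} {M N : Tm Γ σ} → R M N → Compat R M N
  ξ-appL : ∀ {Γ σ τ} {M M' : Tm Γ (σ ⇒ τ)} {N : Tm Γ σ} → Compat R M M' → Compat R (app M N) (app M' N)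
  ξ-appR : ∀ {Γ σ τ} {M : Tm Γ (σ ⇒ τ)} {N N' : Tm Γ σ} → Compat R N N' → Compat R (app M N) (app M N')
  ξ-lam  : ∀ {Γ σ τ} {M M' : Tm (σ ∷ Γ) τ} → Compat R M M' → Compat R (lam M) (lam M')
  ξ-Y    : ∀ {Γ σ} {M M' : Tm Γ (σ ⇒ σ)} → Compat R M M' → Compat R (Y M) (Y M')

_⟶_ : Tm Γ σ → Tm Γ σ → Set
_⟶_ = Compat BasePCF

_⟶*_ : Tm Γ σ → Tm Γ σ → Set
_⟶*_ = Star _⟶_

_⟶βY_ : Tm Γ σ → Tm Γ σ → Set
_⟶βY_ = Compat BaseβY

_⟶βY*_ : Tm Γ σ → Tm Γ σ → Set
_⟶βY*_ = Star _⟶βY_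

-- Hole Γ σ Δ τ : a context of type τ in Δ whose hole has type σ in Γ
data Hole (Γ : Ctx) (σ : Ty) : Ctx → Ty → Set where
  []ₕ   : Hole Γ σ Γ σ
  appLₕ : Hole Γ σ Δ (α ⇒ β) → Tm Δ α → Hole Γ σ Δ β
  appRₕ : Tm Δ (α ⇒ β) → Hole Γ σ Δ α → Hole Γ σ Δ β
  lamₕ  : Hole Γ σ (α ∷ Δ) β → Hole Γ σ Δ (α ⇒ β)
  Yₕ    : Hole Γ σ Δ (α ⇒ α) → Hole Γ σ Δ α

plug : Hole Γ σ Δ τ → Tm Γ σ → Tm Δ τ
plug []ₕ         M = M
plug (appLₕ P N) M = app (plug P M) N
plug (appRₕ N P) M = app N (plug P M)
plug (lamₕ P)    M = lam (plug P M)
plug (Yₕ P)      M = Y (plug P M)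

_⊑obs_ : Tm Γ σ → Tm Γ σ → Set
_⊑obs_ {Γ} {σ} M N =
  (P : Hole Γ σ [] ι) (n : ℕ) → plug P M ⟶* num n → plug P N ⟶* num n

_≡obs_ : Tm Γ σ → Tm Γ σ → Set
M ≡obs N = (M ⊑obs N) × (N ⊑obs M)

data _⊑syn_ {Γ} : ∀ {σ} → Tm Γ σ → Tm Γ σ → Set where
  Ω⊑    : ∀ {σ} (N : Tm Γ σ) → Ω σ ⊑syn N
  var⊑  : (x : Γ ∋ σ) → var x ⊑syn var x
  num⊑  : (n : ℕ) → num n ⊑syn num n
  succ⊑ : succ ⊑syn succ
  pred⊑ : pred ⊑syn pred
  ifz⊑  : ifz ⊑syn ifz
  lam⊑  : {M M' : Tm (σ ∷ Γ) τ} → M ⊑syn M' → lam M ⊑syn lam M'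
  app⊑  : {M M' : Tm Γ (σ ⇒ τ)} {N N' : Tm Γ σ} →
          M ⊑syn M' → N ⊑syn N' → app M N ⊑syn app M' N'
  Y⊑    : {M M' : Tm Γ (σ ⇒ σ)} → M ⊑syn M' → Y M ⊑syn Y M'

predIter : ℕ → Tm Γ ι → Tm Γ ι
predIter zero    x = x
predIter (suc k) x = app pred (predIter k x)

ite : Tm Γ ι → Tm Γ ι → Tm Γ ι → Tm Γ ι
ite b t e = app (app (app ifz b) t) e

-- if pred^k x then k else if pred^(k+1) x then k+1 else ... if pred^(k+n) x then k+n else Ω
fpBody : ℕ → ℕ → Tm (ι ∷ Γ) ι
fpBody k zero    = ite (predIter k (var here)) (num k) (Ω ι)
fpBody k (suc n) = ite (predIter k (var here)) (num k) (fpBody (suc k) n)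

FP : (σ : Ty) → ℕ → Tm Γ (σ ⇒ σ)
FP ι       i = lam (fpBody 0 i)
FP (σ ⇒ τ) i = lam (lam (app (FP τ i) (app (var (there here)) (app (FP σ i) (var here)))))

Finite : Tm [] σ → Set
Finite {σ} M = ∃ λ i → M ≡obs app (FP σ i) M

-- ω (Böhm-tree-like approximant of a term)

mutual
  -- λx₁…xₙ. u M₁…Mₘ  ↦  just (λx₁…xₙ. u ω(M₁)…ω(Mₘ)), otherwise nothing
  ωλ : Tm Γ σ → Maybe (Tm Γ σ)
  ωλ (lam M)   = Maybe.map lam (ωλ M)
  ωλ (var x)   = just (var x)
  ωλ (num n)   = just (num n)
  ωλ succ      = just succ
  ωλ pred      = just pred
  ωλ ifz       = just ifz
  ωλ (Ω σ)     = nothing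
  ωλ (Y M)     = nothing
  ωλ (app M N) = ωsp (app M N)

  ωsp : Tm Γ σ → Maybe (Tm Γ σ)
  ωsp (var x)   = just (var x)
  ωsp (num n)   = just (num n)
  ωsp succ      = just succ
  ωsp pred      = just pred
  ωsp ifz       = just ifz
  ωsp (Ω σ)     = nothing
  ωsp (Y M)     = nothing
  ωsp (lam M)   = nothing
  ωsp (app M N) = Maybe.map (λ h → app h (ω N)) (ωsp M)

  ω : Tm Γ σ → Tm Γ σ
  ω {σ = σ} M = fromMaybe (Ω σ) (ωλ M)

-- approx(M): the ⊑syn-least N' with N' ≡obs M and N' ⊑syn ω(N) for some N with M →*βY N

Candidate : Tm [] σ → Tm [] σ → Set
Candidate M N' = (N' ≡obs M) × (∃ λ N → (M ⟶βY* N) × (N' ⊑syn ω N))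

IsApprox : Tm [] σ → Tm [] σ → Set
IsApprox M A = Candidate M A × (∀ A' → Candidate M A' → A ⊑syn A')

{-# OPTIONS --safe #-}
-- Let A ⊑syn ω M₁ with M →βY* M₁ witness that A is a candidate for M, and similarly
-- B ⊑syn ω N₂ with N →βY* N₂. Reductions of M can be replayed on N along ⊑syn, βY is
-- confluent and ω grows along βY reduction, so A and B lie below a common ω N₃ and
-- therefore have a syntactic meet A ⊓ B. This meet is again a candidate for M: it is
-- ⊑syn A, hence ⊑obs M, and conversely a context that converges on M converges on
-- A and (via N) on B, hence on A ⊓ B by stability of head reduction. Minimality of A
-- gives A ⊑syn A ⊓ B ⊑syn B. Convergence to a numeral is only ever examined along
-- head reduction, which suffices by a standardisation argument.
module Submission where

open import Defs
open import Data.Bool using (Bool; true; false)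
open import Data.Empty using (⊥; ⊥-elim)
open import Data.List using ([]; _∷_)
open import Data.Maybe using (Maybe; just; nothing; fromMaybe)
import Data.Maybe as Maybe
open import Data.Nat using (ℕ; suc)
open import Data.Product using (∃; ∃₂; _×_; _,_; proj₁; proj₂)
open import Data.Unit using (⊤; tt)
open import Relation.Binary.Construct.Closure.ReflexiveTransitive using (Star; ε; _◅_; _◅◅_; gmap)
open import Relation.Binary.PropositionalEquality using (_≡_; refl; sym; trans; cong; cong₂; subst₂)

private variable
  Ξ : Ctx

-- Substitution algebra

_≗ʳ_ : Ren Γ Δ → Ren Γ Δ → Set
_≗ʳ_ {Γ} ρ ρ′ = ∀ {a} (x : Γ ∋ a) → ρ x ≡ ρ′ x

_≗ˢ_ : Sub Γ Δ → Sub Γ Δ → Set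
_≗ˢ_ {Γ} s s′ = ∀ {a} (x : Γ ∋ a) → s x ≡ s′ x

extR-cong : {ρ ρ′ : Ren Γ Δ} → ρ ≗ʳ ρ′ → extR {σ = σ} ρ ≗ʳ extR ρ′
extR-cong e here      = refl
extR-cong e (there x) = cong there (e x)

rename-cong : {ρ ρ′ : Ren Γ Δ} → ρ ≗ʳ ρ′ → (M : Tm Γ τ) → rename ρ M ≡ rename ρ′ M
rename-cong e (var x)   = cong var (e x)
rename-cong e (num n)   = refl
rename-cong e succ      = refl
rename-cong e pred      = refl
rename-cong e ifz       = refl
rename-cong e (Ω σ)     = refl
rename-cong e (lam M)   = cong lam (rename-cong (extR-cong e) M)
rename-cong e (app M N) = cong₂ app (rename-cong e M) (rename-cong e N)
rename-cong e (Y M)     = cong Y (rename-cong e M)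

extS-cong : {s s′ : Sub Γ Δ} → s ≗ˢ s′ → extS {σ = σ} s ≗ˢ extS s′
extS-cong e here      = refl
extS-cong e (there x) = cong (rename there) (e x)

subst-cong : {s s′ : Sub Γ Δ} → s ≗ˢ s′ → (M : Tm Γ τ) → subst s M ≡ subst s′ M
subst-cong e (var x)   = e x
subst-cong e (num n)   = refl
subst-cong e succ      = refl
subst-cong e pred      = refl
subst-cong e ifz       = refl
subst-cong e (Ω σ)     = refl
subst-cong e (lam M)   = cong lam (subst-cong (extS-cong e) M)
subst-cong e (app M N) = cong₂ app (subst-cong e M) (subst-cong e N)
subst-cong e (Y M)     = cong Y (subst-cong e M)

rename-rename : (ρ : Ren Γ Δ) (ρ′ : Ren Δ Ξ) (M : Tm Γ τ) →
                rename ρ′ (rename ρ M) ≡ rename (λ x → ρ′ (ρ x)) M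
rename-rename ρ ρ′ (var x)   = refl
rename-rename ρ ρ′ (num n)   = refl
rename-rename ρ ρ′ succ      = refl
rename-rename ρ ρ′ pred      = refl
rename-rename ρ ρ′ ifz       = refl
rename-rename ρ ρ′ (Ω σ)     = refl
rename-rename ρ ρ′ (lam M)   = cong lam (trans (rename-rename (extR ρ) (extR ρ′) M)
  (rename-cong (λ { here → refl ; (there x) → refl }) M))
rename-rename ρ ρ′ (app M N) = cong₂ app (rename-rename ρ ρ′ M) (rename-rename ρ ρ′ N)
rename-rename ρ ρ′ (Y M)     = cong Y (rename-rename ρ ρ′ M)

subst-rename : (ρ : Ren Γ Δ) (s : Sub Δ Ξ) (M : Tm Γ τ) →
               subst s (rename ρ M) ≡ subst (λ x → s (ρ x)) M
subst-rename ρ s (var x)   = refl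
subst-rename ρ s (num n)   = refl
subst-rename ρ s succ      = refl
subst-rename ρ s pred      = refl
subst-rename ρ s ifz       = refl
subst-rename ρ s (Ω σ)     = refl
subst-rename ρ s (lam M)   = cong lam (trans (subst-rename (extR ρ) (extS s) M)
  (subst-cong (λ { here → refl ; (there x) → refl }) M))
subst-rename ρ s (app M N) = cong₂ app (subst-rename ρ s M) (subst-rename ρ s N)
subst-rename ρ s (Y M)     = cong Y (subst-rename ρ s M)

rename-subst : (s : Sub Γ Δ) (ρ : Ren Δ Ξ) (M : Tm Γ τ) →
               rename ρ (subst s M) ≡ subst (λ x → rename ρ (s x)) M
rename-subst s ρ (var x)   = refl
rename-subst s ρ (num n)   = refl
rename-subst s ρ succ      = refl
rename-subst s ρ pred      = refl
rename-subst s ρ ifz       = refl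
rename-subst s ρ (Ω σ)     = refl
rename-subst s ρ (lam M)   = cong lam (trans (rename-subst (extS s) (extR ρ) M)
  (subst-cong (λ { here → refl
                 ; (there x) → trans (rename-rename there (extR ρ) (s x))
                                     (sym (rename-rename ρ there (s x))) }) M))
rename-subst s ρ (app M N) = cong₂ app (rename-subst s ρ M) (rename-subst s ρ N)
rename-subst s ρ (Y M)     = cong Y (rename-subst s ρ M)

subst-subst : (s : Sub Γ Δ) (s′ : Sub Δ Ξ) (M : Tm Γ τ) →
              subst s′ (subst s M) ≡ subst (λ x → subst s′ (s x)) M
subst-subst s s′ (var x)   = refl
subst-subst s s′ (num n)   = refl
subst-subst s s′ succ      = refl
subst-subst s s′ pred      = refl
subst-subst s s′ ifz       = refl
subst-subst s s′ (Ω σ)     = refl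
subst-subst s s′ (lam M)   = cong lam (trans (subst-subst (extS s) (extS s′) M)
  (subst-cong (λ { here → refl
                 ; (there x) → trans (subst-rename there (extS s′) (s x))
                                     (sym (rename-subst s′ there (s x))) }) M))
subst-subst s s′ (app M N) = cong₂ app (subst-subst s s′ M) (subst-subst s s′ N)
subst-subst s s′ (Y M)     = cong Y (subst-subst s s′ M)

subst-id : (M : Tm Γ τ) → subst var M ≡ M
subst-id (var x)   = refl
subst-id (num n)   = refl
subst-id succ      = refl
subst-id pred      = refl
subst-id ifz       = refl
subst-id (Ω σ)     = refl
subst-id (lam M)   = cong lam (trans (subst-cong (λ { here → refl ; (there x) → refl }) M) (subst-id M))
subst-id (app M N) = cong₂ app (subst-id M) (subst-id N)
subst-id (Y M)     = cong Y (subst-id M)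

_∷ˢ_ : Tm Δ σ → Sub Γ Δ → Sub (σ ∷ Γ) Δ
(N ∷ˢ s) here      = N
(N ∷ˢ s) (there x) = s x

subst-[] : (s : Sub Γ Δ) (M : Tm (σ ∷ Γ) τ) (N : Tm Γ σ) →
           subst s (M [ N ]) ≡ subst (subst s N ∷ˢ s) M
subst-[] s M N = trans (subst-subst (single N) s M) (subst-cong (λ { here → refl ; (there x) → refl }) M)

subst-extS-[] : (s : Sub Γ Δ) (M : Tm (σ ∷ Γ) τ) (N : Tm Δ σ) →
                (subst (extS s) M [ N ]) ≡ subst (N ∷ˢ s) M
subst-extS-[] s M N = trans (subst-subst (extS s) (single N) M)
  (subst-cong (λ { here → refl
                 ; (there x) → trans (subst-rename there (single N) (s x)) (subst-id (s x)) }) M)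

subst-[]-comm : (s : Sub Γ Δ) (M : Tm (σ ∷ Γ) τ) (N : Tm Γ σ) →
                subst s (M [ N ]) ≡ (subst (extS s) M [ subst s N ])
subst-[]-comm s M N = trans (subst-[] s M N) (sym (subst-extS-[] s M (subst s N)))

rename-[]-comm : (ρ : Ren Γ Δ) (M : Tm (σ ∷ Γ) τ) (N : Tm Γ σ) →
                 rename ρ (M [ N ]) ≡ (rename (extR ρ) M [ rename ρ N ])
rename-[]-comm ρ M N = trans (rename-subst (single N) ρ M)
  (trans (subst-cong (λ { here → refl ; (there x) → refl }) M)
         (sym (subst-rename (extR ρ) (single (rename ρ N)) M)))

⊑syn-refl : (M : Tm Γ τ) → M ⊑syn M
⊑syn-refl (var x)   = var⊑ x
⊑syn-refl (num n)   = num⊑ n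
⊑syn-refl succ      = succ⊑
⊑syn-refl pred      = pred⊑
⊑syn-refl ifz       = ifz⊑
⊑syn-refl (Ω σ)     = Ω⊑ _
⊑syn-refl (lam M)   = lam⊑ (⊑syn-refl M)
⊑syn-refl (app M N) = app⊑ (⊑syn-refl M) (⊑syn-refl N)
⊑syn-refl (Y M)     = Y⊑ (⊑syn-refl M)

⊑syn-trans : {A B C : Tm Γ τ} → A ⊑syn B → B ⊑syn C → A ⊑syn C
⊑syn-trans (Ω⊑ _)     q            = Ω⊑ _
⊑syn-trans (var⊑ x)   q            = q
⊑syn-trans (num⊑ n)   q            = q
⊑syn-trans succ⊑      q            = q
⊑syn-trans pred⊑      q            = q
⊑syn-trans ifz⊑       q            = q
⊑syn-trans (lam⊑ p)   (lam⊑ q)     = lam⊑ (⊑syn-trans p q)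
⊑syn-trans (app⊑ p p′) (app⊑ q q′) = app⊑ (⊑syn-trans p q) (⊑syn-trans p′ q′)
⊑syn-trans (Y⊑ p)     (Y⊑ q)       = Y⊑ (⊑syn-trans p q)

⊑syn-rename : (ρ : Ren Γ Δ) {M M′ : Tm Γ τ} → M ⊑syn M′ → rename ρ M ⊑syn rename ρ M′
⊑syn-rename ρ (Ω⊑ N)     = Ω⊑ _
⊑syn-rename ρ (var⊑ x)   = var⊑ (ρ x)
⊑syn-rename ρ (num⊑ n)   = num⊑ n
⊑syn-rename ρ succ⊑      = succ⊑
⊑syn-rename ρ pred⊑      = pred⊑
⊑syn-rename ρ ifz⊑       = ifz⊑
⊑syn-rename ρ (lam⊑ p)   = lam⊑ (⊑syn-rename (extR ρ) p)
⊑syn-rename ρ (app⊑ p q) = app⊑ (⊑syn-rename ρ p) (⊑syn-rename ρ q)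
⊑syn-rename ρ (Y⊑ p)     = Y⊑ (⊑syn-rename ρ p)

⊑syn-subst : {s s′ : Sub Γ Δ} → (∀ {a} (x : Γ ∋ a) → s x ⊑syn s′ x) →
             {M M′ : Tm Γ τ} → M ⊑syn M′ → subst s M ⊑syn subst s′ M′
⊑syn-subst h (Ω⊑ N)     = Ω⊑ _
⊑syn-subst h (var⊑ x)   = h x
⊑syn-subst h (num⊑ n)   = num⊑ n
⊑syn-subst h succ⊑      = succ⊑
⊑syn-subst h pred⊑      = pred⊑
⊑syn-subst h ifz⊑       = ifz⊑
⊑syn-subst h (lam⊑ p)   = lam⊑ (⊑syn-subst (λ { here → var⊑ here ; (there x) → ⊑syn-rename there (h x) }) p)
⊑syn-subst h (app⊑ p q) = app⊑ (⊑syn-subst h p) (⊑syn-subst h q)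
⊑syn-subst h (Y⊑ p)     = Y⊑ (⊑syn-subst h p)

⊑syn-[] : {M M′ : Tm (σ ∷ Γ) τ} {N N′ : Tm Γ σ} → M ⊑syn M′ → N ⊑syn N′ → (M [ N ]) ⊑syn (M′ [ N′ ])
⊑syn-[] p q = ⊑syn-subst (λ { here → q ; (there x) → var⊑ x }) p

⊑syn-plug : (P : Hole Γ σ Δ τ) {M M′ : Tm Γ σ} → M ⊑syn M′ → plug P M ⊑syn plug P M′
⊑syn-plug []ₕ         p = p
⊑syn-plug (appLₕ P N) p = app⊑ (⊑syn-plug P p) (⊑syn-refl N)
⊑syn-plug (appRₕ N P) p = app⊑ (⊑syn-refl N) (⊑syn-plug P p)
⊑syn-plug (lamₕ P)    p = lam⊑ (⊑syn-plug P p)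
⊑syn-plug (Yₕ P)      p = Y⊑ (⊑syn-plug P p)

-- Meets of terms bounded above

data Meet {Γ} : ∀ {σ} → Tm Γ σ → Tm Γ σ → Tm Γ σ → Set where
  Ωˡ   : ∀ {σ} (N : Tm Γ σ) → Meet (Ω σ) N (Ω σ)
  Ωʳ   : ∀ {σ} (N : Tm Γ σ) → Meet N (Ω σ) (Ω σ)
  var  : (x : Γ ∋ σ) → Meet (var x) (var x) (var x)
  num  : (n : ℕ) → Meet (num n) (num n) (num n)
  succ : Meet succ succ succ
  pred : Meet pred pred pred
  ifz  : Meet ifz ifz ifz
  lam  : {M M′ Z : Tm (σ ∷ Γ) τ} → Meet M M′ Z → Meet (lam M) (lam M′) (lam Z)
  app  : {M M′ Z : Tm Γ (σ ⇒ τ)} {N N′ W : Tm Γ σ} →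
         Meet M M′ Z → Meet N N′ W → Meet (app M N) (app M′ N′) (app Z W)
  Y    : {M M′ Z : Tm Γ (σ ⇒ σ)} → Meet M M′ Z → Meet (Y M) (Y M′) (Y Z)

meet-of-bounded : {X X′ U : Tm Γ τ} → X ⊑syn U → X′ ⊑syn U → ∃ λ Z → Meet X X′ Z
meet-of-bounded (Ω⊑ _)    q         = _ , Ωˡ _
meet-of-bounded p         (Ω⊑ _)    = _ , Ωʳ _
meet-of-bounded (var⊑ x)  (var⊑ .x) = _ , var x
meet-of-bounded (num⊑ n)  (num⊑ .n) = _ , num n
meet-of-bounded succ⊑     succ⊑     = _ , succ
meet-of-bounded pred⊑     pred⊑     = _ , pred
meet-of-bounded ifz⊑      ifz⊑      = _ , ifz
meet-of-bounded (lam⊑ p)  (lam⊑ q)  = _ , lam (proj₂ (meet-of-bounded p q))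
meet-of-bounded (app⊑ p p′) (app⊑ q q′) =
  _ , app (proj₂ (meet-of-bounded p q)) (proj₂ (meet-of-bounded p′ q′))
meet-of-bounded (Y⊑ p)    (Y⊑ q)    = _ , Y (proj₂ (meet-of-bounded p q))

meet-sym : {X X′ Z : Tm Γ τ} → Meet X X′ Z → Meet X′ X Z
meet-sym (Ωˡ N)    = Ωʳ N
meet-sym (Ωʳ N)    = Ωˡ N
meet-sym (var x)   = var x
meet-sym (num n)   = num n
meet-sym succ      = succ
meet-sym pred      = pred
meet-sym ifz       = ifz
meet-sym (lam m)   = lam (meet-sym m)
meet-sym (app m n) = app (meet-sym m) (meet-sym n)
meet-sym (Y m)     = Y (meet-sym m)

meet-⊑ˡ : {X X′ Z : Tm Γ τ} → Meet X X′ Z → Z ⊑syn X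
meet-⊑ˡ (Ωˡ N)    = Ω⊑ _
meet-⊑ˡ (Ωʳ N)    = Ω⊑ _
meet-⊑ˡ (var x)   = var⊑ x
meet-⊑ˡ (num n)   = num⊑ n
meet-⊑ˡ succ      = succ⊑
meet-⊑ˡ pred      = pred⊑
meet-⊑ˡ ifz       = ifz⊑
meet-⊑ˡ (lam m)   = lam⊑ (meet-⊑ˡ m)
meet-⊑ˡ (app m n) = app⊑ (meet-⊑ˡ m) (meet-⊑ˡ n)
meet-⊑ˡ (Y m)     = Y⊑ (meet-⊑ˡ m)

meet-⊑ʳ : {X X′ Z : Tm Γ τ} → Meet X X′ Z → Z ⊑syn X′
meet-⊑ʳ m = meet-⊑ˡ (meet-sym m)

meet-idem : (M : Tm Γ τ) → Meet M M M
meet-idem (var x)   = var x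
meet-idem (num n)   = num n
meet-idem succ      = succ
meet-idem pred      = pred
meet-idem ifz       = ifz
meet-idem (Ω σ)     = Ωˡ _
meet-idem (lam M)   = lam (meet-idem M)
meet-idem (app M N) = app (meet-idem M) (meet-idem N)
meet-idem (Y M)     = Y (meet-idem M)

meet-plug : (P : Hole Γ σ Δ τ) {X X′ Z : Tm Γ σ} → Meet X X′ Z → Meet (plug P X) (plug P X′) (plug P Z)
meet-plug []ₕ         m = m
meet-plug (appLₕ P N) m = app (meet-plug P m) (meet-idem N)
meet-plug (appRₕ N P) m = app (meet-idem N) (meet-plug P m)
meet-plug (lamₕ P)    m = lam (meet-plug P m)
meet-plug (Yₕ P)      m = Y (meet-plug P m)

meet-rename : (ρ : Ren Γ Δ) {X X′ Z : Tm Γ τ} → Meet X X′ Z → Meet (rename ρ X) (rename ρ X′) (rename ρ Z)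
meet-rename ρ (Ωˡ N)    = Ωˡ _
meet-rename ρ (Ωʳ N)    = Ωʳ _
meet-rename ρ (var x)   = var (ρ x)
meet-rename ρ (num n)   = num n
meet-rename ρ succ      = succ
meet-rename ρ pred      = pred
meet-rename ρ ifz       = ifz
meet-rename ρ (lam m)   = lam (meet-rename (extR ρ) m)
meet-rename ρ (app m n) = app (meet-rename ρ m) (meet-rename ρ n)
meet-rename ρ (Y m)     = Y (meet-rename ρ m)

meet-subst : {s s′ s″ : Sub Γ Δ} → (∀ {a} (x : Γ ∋ a) → Meet (s x) (s′ x) (s″ x)) →
             {X X′ Z : Tm Γ τ} → Meet X X′ Z → Meet (subst s X) (subst s′ X′) (subst s″ Z)
meet-subst h (Ωˡ N)    = Ωˡ _
meet-subst h (Ωʳ N)    = Ωʳ _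
meet-subst h (var x)   = h x
meet-subst h (num n)   = num n
meet-subst h succ      = succ
meet-subst h pred      = pred
meet-subst h ifz       = ifz
meet-subst h (lam m)   = lam (meet-subst (λ { here → var here ; (there x) → meet-rename there (h x) }) m)
meet-subst h (app m n) = app (meet-subst h m) (meet-subst h n)
meet-subst h (Y m)     = Y (meet-subst h m)

meet-[] : {M M′ Z : Tm (σ ∷ Γ) τ} {N N′ W : Tm Γ σ} → Meet M M′ Z → Meet N N′ W →
          Meet (M [ N ]) (M′ [ N′ ]) (Z [ W ])
meet-[] m n = meet-subst (λ { here → n ; (there x) → var x }) m

-- Parallel reduction and confluence of βY

-- With the flag false this is parallel βY reduction, with true it also contracts
-- arithmetic and conditional redexes.
data Par (arith : Bool) {Γ} : ∀ {σ} → Tm Γ σ → Tm Γ σ → Set where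
  p-var  : ∀ {σ} (x : Γ ∋ σ) → Par arith (var x) (var x)
  p-num  : (n : ℕ) → Par arith (num n) (num n)
  p-succ : Par arith succ succ
  p-pred : Par arith pred pred
  p-ifz  : Par arith ifz ifz
  p-Ω    : ∀ {σ} → Par arith (Ω σ) (Ω σ)
  p-lam  : ∀ {σ τ} {M M′ : Tm (σ ∷ Γ) τ} → Par arith M M′ → Par arith (lam M) (lam M′)
  p-app  : ∀ {σ τ} {M M′ : Tm Γ (σ ⇒ τ)} {N N′ : Tm Γ σ} →
           Par arith M M′ → Par arith N N′ → Par arith (app M N) (app M′ N′)
  p-Y    : ∀ {σ} {M M′ : Tm Γ (σ ⇒ σ)} → Par arith M M′ → Par arith (Y M) (Y M′)
  p-β    : ∀ {σ τ} {M M′ : Tm (σ ∷ Γ) τ} {N N′ : Tm Γ σ} →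
           Par arith M M′ → Par arith N N′ → Par arith (app (lam M) N) (M′ [ N′ ])
  p-Yr   : ∀ {σ} {M M′ : Tm Γ (σ ⇒ σ)} → Par arith M M′ → Par arith (Y M) (app M′ (Y M′))
  p-succ-n : arith ≡ true → (n : ℕ) → Par arith (app succ (num n)) (num (suc n))
  p-pred-0 : arith ≡ true → Par arith (app pred (num 0)) (num 0)
  p-pred-s : arith ≡ true → (n : ℕ) → Par arith (app pred (num (suc n))) (num n)
  p-if-0   : arith ≡ true → {M M′ N : Tm Γ ι} → Par arith M M′ →
             Par arith (app (app (app ifz (num 0)) M) N) M′
  p-if-s   : arith ≡ true → (n : ℕ) {M N N′ : Tm Γ ι} → Par arith N N′ →
             Par arith (app (app (app ifz (num (suc n))) M) N) N′

Par* : Bool → Tm Γ τ → Tm Γ τ → Set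
Par* arith = Star (Par arith)

par-refl : ∀ {arith} (M : Tm Γ τ) → Par arith M M
par-refl (var x)   = p-var x
par-refl (num n)   = p-num n
par-refl succ      = p-succ
par-refl pred      = p-pred
par-refl ifz       = p-ifz
par-refl (Ω σ)     = p-Ω
par-refl (lam M)   = p-lam (par-refl M)
par-refl (app M N) = p-app (par-refl M) (par-refl N)
par-refl (Y M)     = p-Y (par-refl M)

par-rename : ∀ {arith} (ρ : Ren Γ Δ) {M M′ : Tm Γ τ} → Par arith M M′ →
             Par arith (rename ρ M) (rename ρ M′)
par-rename ρ (p-var x)   = p-var (ρ x)
par-rename ρ (p-num n)   = p-num n
par-rename ρ p-succ      = p-succ
par-rename ρ p-pred      = p-pred
par-rename ρ p-ifz       = p-ifz
par-rename ρ p-Ω         = p-Ω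
par-rename ρ (p-lam d)   = p-lam (par-rename (extR ρ) d)
par-rename ρ (p-app d e) = p-app (par-rename ρ d) (par-rename ρ e)
par-rename ρ (p-Y d)     = p-Y (par-rename ρ d)
par-rename ρ (p-β {M′ = M′} {N′ = N′} d e) rewrite rename-[]-comm ρ M′ N′ =
  p-β (par-rename (extR ρ) d) (par-rename ρ e)
par-rename ρ (p-Yr d)         = p-Yr (par-rename ρ d)
par-rename ρ (p-succ-n a n)   = p-succ-n a n
par-rename ρ (p-pred-0 a)     = p-pred-0 a
par-rename ρ (p-pred-s a n)   = p-pred-s a n
par-rename ρ (p-if-0 a d)     = p-if-0 a (par-rename ρ d)
par-rename ρ (p-if-s a n d)   = p-if-s a n (par-rename ρ d)

ParSub : Bool → Sub Γ Δ → Sub Γ Δ → Set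
ParSub {Γ} arith s s′ = ∀ {a} (x : Γ ∋ a) → Par arith (s x) (s′ x)

parSub-extS : ∀ {arith} {s s′ : Sub Γ Δ} → ParSub arith s s′ → ParSub arith (extS {σ = σ} s) (extS s′)
parSub-extS h here      = p-var here
parSub-extS h (there x) = par-rename there (h x)

par-subst : ∀ {arith} {s s′ : Sub Γ Δ} → ParSub arith s s′ →
            {M M′ : Tm Γ τ} → Par arith M M′ → Par arith (subst s M) (subst s′ M′)
par-subst h (p-var x)   = h x
par-subst h (p-num n)   = p-num n
par-subst h p-succ      = p-succ
par-subst h p-pred      = p-pred
par-subst h p-ifz       = p-ifz
par-subst h p-Ω         = p-Ω
par-subst h (p-lam d)   = p-lam (par-subst (parSub-extS h) d)
par-subst h (p-app d e) = p-app (par-subst h d) (par-subst h e)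
par-subst h (p-Y d)     = p-Y (par-subst h d)
par-subst {s′ = s′} h (p-β {M′ = M′} {N′ = N′} d e) rewrite subst-[]-comm s′ M′ N′ =
  p-β (par-subst (parSub-extS h) d) (par-subst h e)
par-subst h (p-Yr d)        = p-Yr (par-subst h d)
par-subst h (p-succ-n a n)  = p-succ-n a n
par-subst h (p-pred-0 a)    = p-pred-0 a
par-subst h (p-pred-s a n)  = p-pred-s a n
par-subst h (p-if-0 a d)    = p-if-0 a (par-subst h d)
par-subst h (p-if-s a n d)  = p-if-s a n (par-subst h d)

par-[] : ∀ {arith} {M M′ : Tm (σ ∷ Γ) τ} {N N′ : Tm Γ σ} →
         Par arith M M′ → Par arith N N′ → Par arith (M [ N ]) (M′ [ N′ ])
par-[] d e = par-subst (λ { here → e ; (there x) → p-var x }) d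

βY⇒par : {M M′ : Tm Γ τ} → M ⟶βY M′ → Par false M M′
βY⇒par (base (β-rule M N)) = p-β (par-refl M) (par-refl N)
βY⇒par (base (Y-rule M))   = p-Yr (par-refl M)
βY⇒par (ξ-appL s)          = p-app (βY⇒par s) (par-refl _)
βY⇒par (ξ-appR s)          = p-app (par-refl _) (βY⇒par s)
βY⇒par (ξ-lam s)           = p-lam (βY⇒par s)
βY⇒par (ξ-Y s)             = p-Y (βY⇒par s)

βY*⇒par* : {M M′ : Tm Γ τ} → M ⟶βY* M′ → Par* false M M′
βY*⇒par* = gmap _ βY⇒par

⟶⇒par : {X X′ : Tm Γ τ} → X ⟶ X′ → Par true X X′
⟶⇒par (base (βY (β-rule M N))) = p-β (par-refl M) (par-refl N)
⟶⇒par (base (βY (Y-rule M)))   = p-Yr (par-refl M)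
⟶⇒par (base (succ-n n))        = p-succ-n refl n
⟶⇒par (base pred-0)            = p-pred-0 refl
⟶⇒par (base (pred-s n))        = p-pred-s refl n
⟶⇒par (base (if-0 M N))        = p-if-0 refl (par-refl M)
⟶⇒par (base (if-s n M N))      = p-if-s refl n (par-refl N)
⟶⇒par (ξ-appL s)               = p-app (⟶⇒par s) (par-refl _)
⟶⇒par (ξ-appR s)               = p-app (par-refl _) (⟶⇒par s)
⟶⇒par (ξ-lam s)                = p-lam (⟶⇒par s)
⟶⇒par (ξ-Y s)                  = p-Y (⟶⇒par s)

develop : Tm Γ τ → Tm Γ τ
develop (app (lam M) N) = develop M [ develop N ]
develop (app M N)       = app (develop M) (develop N)
develop (Y M)           = app (develop M) (Y (develop M))
develop (lam M)         = lam (develop M)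
develop (var x)         = var x
develop (num n)         = num n
develop succ            = succ
develop pred            = pred
develop ifz             = ifz
develop (Ω σ)           = Ω σ

par-triangle : {M M′ : Tm Γ τ} → Par false M M′ → Par false M′ (develop M)
par-triangle (p-var x)               = p-var x
par-triangle (p-num n)               = p-num n
par-triangle p-succ                  = p-succ
par-triangle p-pred                  = p-pred
par-triangle p-ifz                   = p-ifz
par-triangle p-Ω                     = p-Ω
par-triangle (p-lam d)               = p-lam (par-triangle d)
par-triangle (p-app (p-lam d) e)     = p-β (par-triangle d) (par-triangle e)
par-triangle (p-app d@(p-var _) e)   = p-app (par-triangle d) (par-triangle e)
par-triangle (p-app d@p-succ e)      = p-app (par-triangle d) (par-triangle e)
par-triangle (p-app d@p-pred e)      = p-app (par-triangle d) (par-triangle e)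
par-triangle (p-app d@p-ifz e)       = p-app (par-triangle d) (par-triangle e)
par-triangle (p-app d@p-Ω e)         = p-app (par-triangle d) (par-triangle e)
par-triangle (p-app d@(p-app _ _) e) = p-app (par-triangle d) (par-triangle e)
par-triangle (p-app d@(p-Y _) e)     = p-app (par-triangle d) (par-triangle e)
par-triangle (p-app d@(p-β _ _) e)   = p-app (par-triangle d) (par-triangle e)
par-triangle (p-app d@(p-Yr _) e)    = p-app (par-triangle d) (par-triangle e)
par-triangle (p-Y d)                 = p-Yr (par-triangle d)
par-triangle (p-β d e)               = par-[] (par-triangle d) (par-triangle e)
par-triangle (p-Yr d)                = p-app (par-triangle d) (p-Y (par-triangle d))
par-triangle (p-succ-n () n)
par-triangle (p-pred-0 ())
par-triangle (p-pred-s () n)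
par-triangle (p-if-0 () d)
par-triangle (p-if-s () n d)

par-strip : {M M₁ M₂ : Tm Γ τ} → Par false M M₁ → Par* false M M₂ →
            ∃ λ M₃ → Par* false M₁ M₃ × Par false M₂ M₃
par-strip d ε = _ , ε , d
par-strip d (e ◅ r) with par-strip (par-triangle e) r
... | M₃ , r′ , d′ = M₃ , par-triangle d ◅ r′ , d′

par*-confluent : {M M₁ M₂ : Tm Γ τ} → Par* false M M₁ → Par* false M M₂ →
                 ∃ λ M₃ → Par* false M₁ M₃ × Par* false M₂ M₃
par*-confluent ε r₂ = _ , r₂ , ε
par*-confluent (d ◅ r₁) r₂ with par-strip d r₂
... | M₃ , r′ , d′ with par*-confluent r₁ r′
... | M₄ , r₁′ , r₃ = M₄ , r₁′ , d′ ◅ r₃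

par-sim-⊑syn : {X X′ U : Tm Γ τ} → X ⊑syn U → Par false X X′ → ∃ λ U′ → Par false U U′ × X′ ⊑syn U′
par-sim-⊑syn (Ω⊑ U)    p-Ω          = U , par-refl U , Ω⊑ U
par-sim-⊑syn (var⊑ x)  (p-var .x)   = _ , p-var x , var⊑ x
par-sim-⊑syn (num⊑ n)  (p-num .n)   = _ , p-num n , num⊑ n
par-sim-⊑syn succ⊑     p-succ       = _ , p-succ , succ⊑
par-sim-⊑syn pred⊑     p-pred       = _ , p-pred , pred⊑
par-sim-⊑syn ifz⊑      p-ifz        = _ , p-ifz , ifz⊑
par-sim-⊑syn (lam⊑ q)  (p-lam d) with par-sim-⊑syn q d
... | _ , e , q′ = _ , p-lam e , lam⊑ q′
par-sim-⊑syn (app⊑ q r) (p-app d d′) with par-sim-⊑syn q d | par-sim-⊑syn r d′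
... | _ , e , q′ | _ , e′ , r′ = _ , p-app e e′ , app⊑ q′ r′
par-sim-⊑syn (Y⊑ q)    (p-Y d) with par-sim-⊑syn q d
... | _ , e , q′ = _ , p-Y e , Y⊑ q′
par-sim-⊑syn (app⊑ (lam⊑ q) r) (p-β d d′) with par-sim-⊑syn q d | par-sim-⊑syn r d′
... | _ , e , q′ | _ , e′ , r′ = _ , p-β e e′ , ⊑syn-[] q′ r′
par-sim-⊑syn (Y⊑ q)    (p-Yr d) with par-sim-⊑syn q d
... | _ , e , q′ = _ , p-Yr e , app⊑ q′ (Y⊑ q′)
par-sim-⊑syn _ (p-succ-n () n)
par-sim-⊑syn _ (p-pred-0 ())
par-sim-⊑syn _ (p-pred-s () n)
par-sim-⊑syn _ (p-if-0 () d)
par-sim-⊑syn _ (p-if-s () n d)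

par*-sim-⊑syn : {X X′ U : Tm Γ τ} → X ⊑syn U → Par* false X X′ → ∃ λ U′ → Par* false U U′ × X′ ⊑syn U′
par*-sim-⊑syn q ε = _ , ε , q
par*-sim-⊑syn q (d ◅ r) with par-sim-⊑syn q d
... | _ , e , q′ with par*-sim-⊑syn q′ r
... | U″ , r′ , q″ = U″ , e ◅ r′ , q″

-- Monotonicity of ω

-- nothing stands for Ω, so it lies below everything.
_⊑?_ : Maybe (Tm Γ τ) → Maybe (Tm Γ τ) → Set
nothing ⊑? _      = ⊤
just a  ⊑? just b = a ⊑syn b
just a  ⊑? nothing = ⊥

fromMaybe-Ω-mono : {m m′ : Maybe (Tm Γ τ)} → m ⊑? m′ → fromMaybe (Ω τ) m ⊑syn fromMaybe (Ω τ) m′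
fromMaybe-Ω-mono {m = nothing}             _ = Ω⊑ _
fromMaybe-Ω-mono {m = just a} {m′ = just b} h = h

map-lam-mono : {m m′ : Maybe (Tm (σ ∷ Γ) τ)} → m ⊑? m′ → Maybe.map lam m ⊑? Maybe.map lam m′
map-lam-mono {m = nothing}             _ = tt
map-lam-mono {m = just a} {m′ = just b} h = lam⊑ h

map-app-mono : {m m′ : Maybe (Tm Γ (σ ⇒ τ))} {a a′ : Tm Γ σ} → m ⊑? m′ → a ⊑syn a′ →
               Maybe.map (λ h → app h a) m ⊑? Maybe.map (λ h → app h a′) m′
map-app-mono {m = nothing}             _ _ = tt
map-app-mono {m = just x} {m′ = just y} h q = app⊑ h q

ωλ-ωsp-mono : {X U : Tm Γ τ} → X ⊑syn U → (ωλ X ⊑? ωλ U) × (ωsp X ⊑? ωsp U)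
ωλ-ωsp-mono (Ω⊑ N)     = tt , tt
ωλ-ωsp-mono (var⊑ x)   = var⊑ x , var⊑ x
ωλ-ωsp-mono (num⊑ n)   = num⊑ n , num⊑ n
ωλ-ωsp-mono succ⊑      = succ⊑ , succ⊑
ωλ-ωsp-mono pred⊑      = pred⊑ , pred⊑
ωλ-ωsp-mono ifz⊑       = ifz⊑ , ifz⊑
ωλ-ωsp-mono (lam⊑ q)   = map-lam-mono (proj₁ (ωλ-ωsp-mono q)) , tt
ωλ-ωsp-mono (app⊑ q r) = let h = map-app-mono (proj₂ (ωλ-ωsp-mono q)) (fromMaybe-Ω-mono (proj₁ (ωλ-ωsp-mono r)))
                         in h , h
ωλ-ωsp-mono (Y⊑ q)     = tt , tt

ω-mono : {X U : Tm Γ τ} → X ⊑syn U → ω X ⊑syn ω U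
ω-mono q = fromMaybe-Ω-mono (proj₁ (ωλ-ωsp-mono q))

-- ω sends every βY redex to Ω, so contracting it can only make ω larger.
ωλ-ωsp-par : {X X′ : Tm Γ τ} → Par false X X′ → (ωλ X ⊑? ωλ X′) × (ωsp X ⊑? ωsp X′)
ωλ-ωsp-par (p-var x)   = var⊑ x , var⊑ x
ωλ-ωsp-par (p-num n)   = num⊑ n , num⊑ n
ωλ-ωsp-par p-succ      = succ⊑ , succ⊑
ωλ-ωsp-par p-pred      = pred⊑ , pred⊑
ωλ-ωsp-par p-ifz       = ifz⊑ , ifz⊑
ωλ-ωsp-par p-Ω         = tt , tt
ωλ-ωsp-par (p-lam d)   = map-lam-mono (proj₁ (ωλ-ωsp-par d)) , tt
ωλ-ωsp-par (p-app d e) = let h = map-app-mono (proj₂ (ωλ-ωsp-par d)) (fromMaybe-Ω-mono (proj₁ (ωλ-ωsp-par e)))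
                         in h , h
ωλ-ωsp-par (p-Y d)     = tt , tt
ωλ-ωsp-par (p-β d e)   = tt , tt
ωλ-ωsp-par (p-Yr d)    = tt , tt
ωλ-ωsp-par (p-succ-n () n)
ωλ-ωsp-par (p-pred-0 ())
ωλ-ωsp-par (p-pred-s () n)
ωλ-ωsp-par (p-if-0 () d)
ωλ-ωsp-par (p-if-s () n d)

ω-mono-par* : {X X′ : Tm Γ τ} → Par* false X X′ → ω X ⊑syn ω X′
ω-mono-par* ε       = ⊑syn-refl _
ω-mono-par* (d ◅ r) = ⊑syn-trans (fromMaybe-Ω-mono (proj₁ (ωλ-ωsp-par d))) (ω-mono-par* r)

ω-reducts-bounded : {M N M₁ N₂ : Tm Γ τ} → M ⊑syn N → M ⟶βY* M₁ → N ⟶βY* N₂ →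
                    ∃ λ N₃ → (ω M₁ ⊑syn ω N₃) × (ω N₂ ⊑syn ω N₃)
ω-reducts-bounded M⊑N M↠M₁ N↠N₂ with par*-sim-⊑syn M⊑N (βY*⇒par* M↠M₁)
... | N₁ , N↠N₁ , M₁⊑N₁ with par*-confluent N↠N₁ (βY*⇒par* N↠N₂)
... | N₃ , N₁↠N₃ , N₂↠N₃ =
  N₃ , ⊑syn-trans (ω-mono M₁⊑N₁) (ω-mono-par* N₁↠N₃) , ω-mono-par* N₂↠N₃

-- Head reduction

data _⟶h_ {Γ} : ∀ {σ} → Tm Γ σ → Tm Γ σ → Set where
  h-β    : ∀ {σ τ} {M : Tm (σ ∷ Γ) τ} {N : Tm Γ σ} → app (lam M) N ⟶h (M [ N ])
  h-Y    : ∀ {σ} {M : Tm Γ (σ ⇒ σ)} → Y M ⟶h app M (Y M)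
  h-app  : ∀ {σ τ} {M M′ : Tm Γ (σ ⇒ τ)} {N : Tm Γ σ} → M ⟶h M′ → app M N ⟶h app M′ N
  h-succ-n : ∀ {n} → app succ (num n) ⟶h num (suc n)
  h-succ   : {N N′ : Tm Γ ι} → N ⟶h N′ → app succ N ⟶h app succ N′
  h-pred-0 : app pred (num 0) ⟶h num 0
  h-pred-s : ∀ {n} → app pred (num (suc n)) ⟶h num n
  h-pred   : {N N′ : Tm Γ ι} → N ⟶h N′ → app pred N ⟶h app pred N′
  h-if-0   : {M N : Tm Γ ι} → app (app (app ifz (num 0)) M) N ⟶h M
  h-if-s   : ∀ {n} {M N : Tm Γ ι} → app (app (app ifz (num (suc n))) M) N ⟶h N
  h-ifz    : {B B′ : Tm Γ ι} → B ⟶h B′ → app ifz B ⟶h app ifz B′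

_⟶h*_ : Tm Γ σ → Tm Γ σ → Set
_⟶h*_ = Star _⟶h_

⟶h-deterministic : {X X₁ X₂ : Tm Γ τ} → X ⟶h X₁ → X ⟶h X₂ → X₁ ≡ X₂
⟶h-deterministic h-β h-β = refl
⟶h-deterministic h-β (h-app ())
⟶h-deterministic h-Y h-Y = refl
⟶h-deterministic (h-app ()) h-β
⟶h-deterministic (h-app s) (h-app t) = cong (λ z → app z _) (⟶h-deterministic s t)
⟶h-deterministic (h-app (h-app (h-ifz ()))) h-if-0
⟶h-deterministic (h-app (h-app (h-ifz ()))) h-if-s
⟶h-deterministic h-succ-n h-succ-n = refl
⟶h-deterministic h-succ-n (h-succ ())
⟶h-deterministic (h-succ ()) h-succ-n
⟶h-deterministic (h-succ s) (h-succ t) = cong (app succ) (⟶h-deterministic s t)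
⟶h-deterministic h-pred-0 h-pred-0 = refl
⟶h-deterministic h-pred-0 (h-pred ())
⟶h-deterministic h-pred-s h-pred-s = refl
⟶h-deterministic h-pred-s (h-pred ())
⟶h-deterministic (h-pred ()) h-pred-0
⟶h-deterministic (h-pred ()) h-pred-s
⟶h-deterministic (h-pred s) (h-pred t) = cong (app pred) (⟶h-deterministic s t)
⟶h-deterministic h-if-0 h-if-0 = refl
⟶h-deterministic h-if-0 (h-app (h-app (h-ifz ())))
⟶h-deterministic h-if-s h-if-s = refl
⟶h-deterministic h-if-s (h-app (h-app (h-ifz ())))
⟶h-deterministic (h-ifz s) (h-ifz t) = cong (app ifz) (⟶h-deterministic s t)

⟶h-converges-after-step : ∀ {n} {X X₁ : Tm Γ ι} → X ⟶h X₁ → X ⟶h* num n → X₁ ⟶h* num n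
⟶h-converges-after-step () ε
⟶h-converges-after-step s (t ◅ r) rewrite ⟶h-deterministic s t = r

⟶h⇒⟶ : {X X′ : Tm Γ τ} → X ⟶h X′ → X ⟶ X′
⟶h⇒⟶ (h-β {M = M} {N})     = base (βY (β-rule M N))
⟶h⇒⟶ (h-Y {M = M})         = base (βY (Y-rule M))
⟶h⇒⟶ (h-app s)             = ξ-appL (⟶h⇒⟶ s)
⟶h⇒⟶ (h-succ-n {n})        = base (succ-n n)
⟶h⇒⟶ (h-succ s)            = ξ-appR (⟶h⇒⟶ s)
⟶h⇒⟶ h-pred-0              = base pred-0
⟶h⇒⟶ (h-pred-s {n})        = base (pred-s n)
⟶h⇒⟶ (h-pred s)            = ξ-appR (⟶h⇒⟶ s)
⟶h⇒⟶ (h-if-0 {M = M} {N})  = base (if-0 M N)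
⟶h⇒⟶ (h-if-s {n} {M} {N})  = base (if-s n M N)
⟶h⇒⟶ (h-ifz s)             = ξ-appR (⟶h⇒⟶ s)

⟶h*⇒⟶* : {X X′ : Tm Γ τ} → X ⟶h* X′ → X ⟶* X′
⟶h*⇒⟶* = gmap _ ⟶h⇒⟶

⟶h-sim-⊑syn : {X X₁ U : Tm Γ τ} → X ⊑syn U → X ⟶h X₁ → ∃ λ U₁ → (U ⟶h U₁) × X₁ ⊑syn U₁
⟶h-sim-⊑syn (app⊑ (lam⊑ p) q) h-β = _ , h-β , ⊑syn-[] p q
⟶h-sim-⊑syn (Y⊑ p) h-Y = _ , h-Y , app⊑ p (Y⊑ p)
⟶h-sim-⊑syn (app⊑ p q) (h-app s) with ⟶h-sim-⊑syn p s
... | _ , s′ , p′ = _ , h-app s′ , app⊑ p′ q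
⟶h-sim-⊑syn (app⊑ succ⊑ (num⊑ n)) h-succ-n = _ , h-succ-n , num⊑ _
⟶h-sim-⊑syn (app⊑ succ⊑ q) (h-succ s) with ⟶h-sim-⊑syn q s
... | _ , s′ , q′ = _ , h-succ s′ , app⊑ succ⊑ q′
⟶h-sim-⊑syn (app⊑ pred⊑ (num⊑ _)) h-pred-0 = _ , h-pred-0 , num⊑ _
⟶h-sim-⊑syn (app⊑ pred⊑ (num⊑ _)) h-pred-s = _ , h-pred-s , num⊑ _
⟶h-sim-⊑syn (app⊑ pred⊑ q) (h-pred s) with ⟶h-sim-⊑syn q s
... | _ , s′ , q′ = _ , h-pred s′ , app⊑ pred⊑ q′
⟶h-sim-⊑syn (app⊑ (app⊑ (app⊑ ifz⊑ (num⊑ _)) p) q) h-if-0 = _ , h-if-0 , p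
⟶h-sim-⊑syn (app⊑ (app⊑ (app⊑ ifz⊑ (num⊑ _)) p) q) h-if-s = _ , h-if-s , q
⟶h-sim-⊑syn (app⊑ ifz⊑ q) (h-ifz s) with ⟶h-sim-⊑syn q s
... | _ , s′ , q′ = _ , h-ifz s′ , app⊑ ifz⊑ q′

⊑syn-preserves-⟶h*num : ∀ {n} {X U : Tm Γ ι} → X ⊑syn U → X ⟶h* num n → U ⟶h* num n
⊑syn-preserves-⟶h*num (num⊑ _) ε = ε
⊑syn-preserves-⟶h*num p (s ◅ r) with ⟶h-sim-⊑syn p s
... | _ , s′ , p′ = s′ ◅ ⊑syn-preserves-⟶h*num p′ r

-- Stability

data HeadΩ {Γ} : ∀ {σ} → Tm Γ σ → Set where
  Ω-head    : ∀ {σ} → HeadΩ (Ω σ)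
  app-head  : ∀ {σ τ} {M : Tm Γ (σ ⇒ τ)} {N : Tm Γ σ} → HeadΩ M → HeadΩ (app M N)
  succ-head : {N : Tm Γ ι} → HeadΩ N → HeadΩ (app succ N)
  pred-head : {N : Tm Γ ι} → HeadΩ N → HeadΩ (app pred N)
  ifz-head  : {N : Tm Γ ι} → HeadΩ N → HeadΩ (app ifz N)

headΩ-stuck : {X X′ : Tm Γ τ} → HeadΩ X → X ⟶h X′ → ⊥
headΩ-stuck (app-head h) (h-app s)                 = headΩ-stuck h s
headΩ-stuck (app-head (app-head (ifz-head ()))) h-if-0
headΩ-stuck (app-head (app-head (ifz-head ()))) h-if-s
headΩ-stuck (app-head ()) h-β
headΩ-stuck (succ-head h) (h-succ s)               = headΩ-stuck h s
headΩ-stuck (succ-head ()) h-succ-n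
headΩ-stuck (pred-head ()) h-pred-0
headΩ-stuck (pred-head ()) h-pred-s
headΩ-stuck (pred-head h) (h-pred s)               = headΩ-stuck h s
headΩ-stuck (ifz-head h) (h-ifz s)                 = headΩ-stuck h s

headΩ-diverges : ∀ {n} {X : Tm Γ ι} → HeadΩ X → X ⟶h* num n → ⊥
headΩ-diverges () ε
headΩ-diverges h (s ◅ r) = headΩ-stuck h s

meet-⟶h : {X X₁ X′ Z : Tm Γ τ} → Meet X X′ Z → X ⟶h X₁ → (HeadΩ X′ → ⊥) →
          ∃₂ λ X₁′ Z₁ → (X′ ⟶h X₁′) × (Z ⟶h Z₁) × Meet X₁ X₁′ Z₁
meet-⟶h (Ωʳ _) s nh                          = ⊥-elim (nh Ω-head)
meet-⟶h (app (Ωʳ _) _) s nh                  = ⊥-elim (nh (app-head Ω-head))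
meet-⟶h (app (app (Ωʳ _) _) _) s nh          = ⊥-elim (nh (app-head (app-head Ω-head)))
meet-⟶h (app (app (app (Ωʳ _) _) _) _) s nh  = ⊥-elim (nh (app-head (app-head (app-head Ω-head))))
meet-⟶h (app succ (Ωʳ _)) s nh               = ⊥-elim (nh (succ-head Ω-head))
meet-⟶h (app pred (Ωʳ _)) s nh               = ⊥-elim (nh (pred-head Ω-head))
meet-⟶h (app (app (app ifz (Ωʳ _)) _) _) s nh = ⊥-elim (nh (app-head (app-head (ifz-head Ω-head))))
meet-⟶h (app (lam m) n) h-β nh = _ , _ , h-β , h-β , meet-[] m n
meet-⟶h (Y m) h-Y nh           = _ , _ , h-Y , h-Y , app m (Y m)
meet-⟶h (app m n) (h-app s) nh with meet-⟶h m s (λ h → nh (app-head h))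
... | _ , _ , s′ , t , m₁ = _ , _ , h-app s′ , h-app t , app m₁ n
meet-⟶h (app succ (num _)) h-succ-n nh = _ , _ , h-succ-n , h-succ-n , num _
meet-⟶h (app succ m) (h-succ s) nh with meet-⟶h m s (λ h → nh (succ-head h))
... | _ , _ , s′ , t , m₁ = _ , _ , h-succ s′ , h-succ t , app succ m₁
meet-⟶h (app pred (num _)) h-pred-0 nh = _ , _ , h-pred-0 , h-pred-0 , num _
meet-⟶h (app pred (num _)) h-pred-s nh = _ , _ , h-pred-s , h-pred-s , num _
meet-⟶h (app pred m) (h-pred s) nh with meet-⟶h m s (λ h → nh (pred-head h))
... | _ , _ , s′ , t , m₁ = _ , _ , h-pred s′ , h-pred t , app pred m₁
meet-⟶h (app (app (app ifz (num _)) m) _) h-if-0 nh = _ , _ , h-if-0 , h-if-0 , m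
meet-⟶h (app (app (app ifz (num _)) _) n) h-if-s nh = _ , _ , h-if-s , h-if-s , n
meet-⟶h (app ifz m) (h-ifz s) nh with meet-⟶h m s (λ h → nh (ifz-head h))
... | _ , _ , s′ , t , m₁ = _ , _ , h-ifz s′ , h-ifz t , app ifz m₁

meet-⟶h*num : ∀ {n} {X X′ Z : Tm Γ ι} → Meet X X′ Z → X ⟶h* num n → X′ ⟶h* num n → Z ⟶h* num n
meet-⟶h*num (num _) ε _  = ε
meet-⟶h*num (Ωʳ _)  ε r′ = ⊥-elim (headΩ-diverges Ω-head r′)
meet-⟶h*num m (s ◅ r) r′ with meet-⟶h m s (λ h → headΩ-diverges h r′)
... | _ , _ , s′ , t , m₁ = t ◅ meet-⟶h*num m₁ r (⟶h-converges-after-step s′ r′)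

-- Standardisation

-- succ, pred and ifz evaluate their (first) argument by head reduction, so Internal
-- treats that argument as a head position rather than allowing parallel steps in it.
Strict : Tm Γ τ → Set
Strict succ = ⊤
Strict pred = ⊤
Strict ifz  = ⊤
Strict _    = ⊥

data Internal {Γ} : ∀ {σ} → Tm Γ σ → Tm Γ σ → Set where
  i-var  : ∀ {σ} (x : Γ ∋ σ) → Internal (var x) (var x)
  i-num  : (n : ℕ) → Internal (num n) (num n)
  i-succ : Internal succ succ
  i-pred : Internal pred pred
  i-ifz  : Internal ifz ifz
  i-Ω    : ∀ {σ} → Internal (Ω σ) (Ω σ)
  i-lam  : ∀ {σ τ} {M M′ : Tm (σ ∷ Γ) τ} → Par true M M′ → Internal (lam M) (lam M′)
  i-Y    : ∀ {σ} {M M′ : Tm Γ (σ ⇒ σ)} → Par true M M′ → Internal (Y M) (Y M′)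
  i-app  : ∀ {σ τ} {M M′ : Tm Γ (σ ⇒ τ)} {N N′ : Tm Γ σ} →
           (Strict M → ⊥) → Internal M M′ → Par true N N′ → Internal (app M N) (app M′ N′)
  i-app-succ : {N N′ : Tm Γ ι} → Internal N N′ → Internal (app succ N) (app succ N′)
  i-app-pred : {N N′ : Tm Γ ι} → Internal N N′ → Internal (app pred N) (app pred N′)
  i-app-ifz  : {N N′ : Tm Γ ι} → Internal N N′ → Internal (app ifz N) (app ifz N′)

internal-⟶h-commute : {W X X₁ : Tm Γ τ} → Internal W X → X ⟶h X₁ → ∃ λ V → (W ⟶h V) × Par true V X₁
internal-⟶h-commute (i-app _ (i-lam p) q) h-β = _ , h-β , par-[] p q
internal-⟶h-commute (i-Y p) h-Y               = _ , h-Y , p-app p (p-Y p)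
internal-⟶h-commute (i-app _ i q) (h-app s) with internal-⟶h-commute i s
... | _ , s′ , p = _ , h-app s′ , p-app p q
internal-⟶h-commute (i-app ns i-succ _) h-succ-n     = ⊥-elim (ns tt)
internal-⟶h-commute (i-app ns i-succ _) (h-succ _)   = ⊥-elim (ns tt)
internal-⟶h-commute (i-app ns i-pred _) h-pred-0     = ⊥-elim (ns tt)
internal-⟶h-commute (i-app ns i-pred _) h-pred-s     = ⊥-elim (ns tt)
internal-⟶h-commute (i-app ns i-pred _) (h-pred _)   = ⊥-elim (ns tt)
internal-⟶h-commute (i-app ns i-ifz _) (h-ifz _)     = ⊥-elim (ns tt)
internal-⟶h-commute (i-app _ (i-app _ (i-app ns i-ifz _) _) _) h-if-0 = ⊥-elim (ns tt)
internal-⟶h-commute (i-app _ (i-app _ (i-app ns i-ifz _) _) _) h-if-s = ⊥-elim (ns tt)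
internal-⟶h-commute (i-app-succ (i-num _)) h-succ-n = _ , h-succ-n , p-num _
internal-⟶h-commute (i-app-succ i) (h-succ s) with internal-⟶h-commute i s
... | _ , s′ , p = _ , h-succ s′ , p-app p-succ p
internal-⟶h-commute (i-app-pred (i-num _)) h-pred-0 = _ , h-pred-0 , p-num _
internal-⟶h-commute (i-app-pred (i-num _)) h-pred-s = _ , h-pred-s , p-num _
internal-⟶h-commute (i-app-pred i) (h-pred s) with internal-⟶h-commute i s
... | _ , s′ , p = _ , h-pred s′ , p-app p-pred p
internal-⟶h-commute (i-app _ (i-app _ (i-app-ifz (i-num _)) p) _) h-if-0 = _ , h-if-0 , p
internal-⟶h-commute (i-app _ (i-app _ (i-app-ifz (i-num _)) _) q) h-if-s = _ , h-if-s , q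
internal-⟶h-commute (i-app-ifz i) (h-ifz s) with internal-⟶h-commute i s
... | _ , s′ , p = _ , h-ifz s′ , p-app p-ifz p

Standard : Tm Γ τ → Tm Γ τ → Set
Standard X X′ = ∃ λ W → (X ⟶h* W) × Internal W X′

standard-⟶h-prepend : {X X₁ X′ : Tm Γ τ} → X ⟶h X₁ → Standard X₁ X′ → Standard X X′
standard-⟶h-prepend s (W , r , i) = W , s ◅ r , i

standard-app : {M M′ : Tm Γ (σ ⇒ τ)} {N N′ : Tm Γ σ} →
               Standard M M′ → Par true N N′ → Standard N N′ → Standard (app M N) (app M′ N′)
standard-app (_ , r , i-succ) _ (_ , r′ , i′) = _ , gmap _ h-app r ◅◅ gmap _ h-succ r′ , i-app-succ i′
standard-app (_ , r , i-pred) _ (_ , r′ , i′) = _ , gmap _ h-app r ◅◅ gmap _ h-pred r′ , i-app-pred i′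
standard-app (_ , r , i-ifz)  _ (_ , r′ , i′) = _ , gmap _ h-app r ◅◅ gmap _ h-ifz r′ , i-app-ifz i′
standard-app (_ , r , i@(i-var _))        p _ = _ , gmap _ h-app r , i-app (λ ()) i p
standard-app (_ , r , i@i-Ω)              p _ = _ , gmap _ h-app r , i-app (λ ()) i p
standard-app (_ , r , i@(i-lam _))        p _ = _ , gmap _ h-app r , i-app (λ ()) i p
standard-app (_ , r , i@(i-Y _))          p _ = _ , gmap _ h-app r , i-app (λ ()) i p
standard-app (_ , r , i@(i-app _ _ _))    p _ = _ , gmap _ h-app r , i-app (λ ()) i p
standard-app (_ , r , i@(i-app-ifz _))    p _ = _ , gmap _ h-app r , i-app (λ ()) i p

par-subst-standard : {M M′ : Tm Γ τ} → Par true M M′ → {s s′ : Sub Γ Δ} →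
                     ParSub true s s′ → (∀ {a} (x : Γ ∋ a) → Standard (s x) (s′ x)) →
                     Standard (subst s M) (subst s′ M′)
par-subst-standard (p-var x)   hp hs = hs x
par-subst-standard (p-num n)   hp hs = _ , ε , i-num n
par-subst-standard p-succ      hp hs = _ , ε , i-succ
par-subst-standard p-pred      hp hs = _ , ε , i-pred
par-subst-standard p-ifz       hp hs = _ , ε , i-ifz
par-subst-standard p-Ω         hp hs = _ , ε , i-Ω
par-subst-standard (p-lam d)   hp hs = _ , ε , i-lam (par-subst (parSub-extS hp) d)
par-subst-standard (p-app d e) hp hs =
  standard-app (par-subst-standard d hp hs) (par-subst hp e) (par-subst-standard e hp hs)
par-subst-standard (p-Y d)     hp hs = _ , ε , i-Y (par-subst hp d)
par-subst-standard (p-Yr d)    hp hs =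
  standard-⟶h-prepend h-Y (standard-app (par-subst-standard d hp hs) (p-Y (par-subst hp d))
                                         (_ , ε , i-Y (par-subst hp d)))
par-subst-standard (p-succ-n _ n) hp hs = _ , h-succ-n ◅ ε , i-num _
par-subst-standard (p-pred-0 _)   hp hs = _ , h-pred-0 ◅ ε , i-num _
par-subst-standard (p-pred-s _ n) hp hs = _ , h-pred-s ◅ ε , i-num _
par-subst-standard (p-if-0 _ d)   hp hs = standard-⟶h-prepend h-if-0 (par-subst-standard d hp hs)
par-subst-standard (p-if-s _ n d) hp hs = standard-⟶h-prepend h-if-s (par-subst-standard d hp hs)
par-subst-standard (p-β {M = M} {M′} {N} {N′} d e) {s} {s′} hp hs =
  standard-⟶h-prepend h-β
    (subst₂ Standard (sym (subst-extS-[] s M (subst s N))) (sym (subst-[] s′ M′ N′))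
      (par-subst-standard d (λ { here → par-subst hp e ; (there x) → hp x })
                            (λ { here → par-subst-standard e hp hs ; (there x) → hs x })))

par⇒standard : {M M′ : Tm Γ τ} → Par true M M′ → Standard M M′
par⇒standard {M = M} {M′} d =
  subst₂ Standard (subst-id M) (subst-id M′) (par-subst-standard d p-var (λ x → _ , ε , i-var x))

par-reflects-⟶h*num : ∀ {n} {X X′ : Tm Γ ι} → Par true X X′ → X′ ⟶h* num n → X ⟶h* num n
par-reflects-⟶h*num d r with par⇒standard d
par-reflects-⟶h*num d ε       | _ , r′ , i-num _ = r′
par-reflects-⟶h*num d (s ◅ r) | _ , r′ , i with internal-⟶h-commute i s
... | _ , s′ , d′ = r′ ◅◅ s′ ◅ par-reflects-⟶h*num d′ r

⟶*num⇒⟶h*num : ∀ {n} {X : Tm Γ ι} → X ⟶* num n → X ⟶h* num n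
⟶*num⇒⟶h*num ε       = ε
⟶*num⇒⟶h*num (s ◅ r) = par-reflects-⟶h*num (⟶⇒par s) (⟶*num⇒⟶h*num r)

⊑syn⇒⊑obs : {M N : Tm Γ σ} → M ⊑syn N → M ⊑obs N
⊑syn⇒⊑obs M⊑N P n r = ⟶h*⇒⟶* (⊑syn-preserves-⟶h*num (⊑syn-plug P M⊑N) (⟶*num⇒⟶h*num r))

meet-⊑obs : {X X′ Z : Tm Γ σ} → Meet X X′ Z → (M : Tm Γ σ) → M ⊑obs X → M ⊑obs X′ → M ⊑obs Z
meet-⊑obs X⊓X′≡Z M M⊑X M⊑X′ P n r =
  ⟶h*⇒⟶* (meet-⟶h*num (meet-plug P X⊓X′≡Z) (⟶*num⇒⟶h*num (M⊑X P n r)) (⟶*num⇒⟶h*num (M⊑X′ P n r)))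

meet-≡obs : {M N A B D : Tm Γ σ} → M ⊑syn N → A ≡obs M → B ≡obs N → Meet A B D → D ≡obs M
meet-≡obs M⊑N (A⊑M , M⊑A) (_ , N⊑B) A⊓B≡D =
    (λ P n r → A⊑M P n (⊑syn⇒⊑obs (meet-⊑ˡ A⊓B≡D) P n r))
  , meet-⊑obs A⊓B≡D _ M⊑A (λ P n r → N⊑B P n (⊑syn⇒⊑obs M⊑N P n r))

-- The hypotheses Finite M and Finite N are what guarantees that approximants exist.
lemma4p4 : (σ : Ty) (M N : Tm [] σ) → Finite M → Finite N → M ⊑syn N →
           (A B : Tm [] σ) → IsApprox M A → IsApprox N B → A ⊑syn B
lemma4p4 σ M N _ _ M⊑N A B ((A≡M , M₁ , M↠M₁ , A⊑ωM₁) , A-least) ((B≡N , N₂ , N↠N₂ , B⊑ωN₂) , _)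
  with ω-reducts-bounded M⊑N M↠M₁ N↠N₂
... | N₃ , ωM₁⊑ωN₃ , ωN₂⊑ωN₃
  with meet-of-bounded (⊑syn-trans A⊑ωM₁ ωM₁⊑ωN₃) (⊑syn-trans B⊑ωN₂ ωN₂⊑ωN₃)
... | D , A⊓B≡D = ⊑syn-trans (A-least D D-candidate) (meet-⊑ʳ A⊓B≡D)
  where
  D-candidate : Candidate M D
  D-candidate = meet-≡obs M⊑N A≡M B≡N A⊓B≡D , M₁ , M↠M₁ , ⊑syn-trans (meet-⊑ˡ A⊓B≡D) A⊑ωM₁
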